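{- A finite connected graph $G$ is meshed if and only if for any metric triangle $vxy$ of $G$ with $d(x,y)=2$, we have $d(v,x)=d(v,y)=2$ and there exists a common neighbor $z$ of $x$ and $y$ with $d(v,z)=2$.
   Context: $d$ is the shortest-path distance of $G$ and $I(u,w)=\{t: d(u,t)+d(t,w)=d(u,w)\}$. Three vertices $x,y,z$ form a metric triangle $xyz$ if $I(x,y)\cap I(x,z)=\{x\}$, $I(x,y)\cap I(y,z)=\{y\}$ and $I(x,z)\cap I(y,z)=\{z\}$. $G$ is meshed if for any three vertices $v,x,y$ with $d(x,y)=2$ there exists a common neighbor $z$ of $x$ and $y$ such that $2d(v,z)\le d(v,x)+d(v,y)$. -}

module Defs where

open import Data.Nat using (ℕ; zero; suc; _+_; _*_; _≤_)
open import Data.Fin using (Fin)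
open import Data.Product using (Σ; _×_; ∃)
open import Relation.Binary.PropositionalEquality using (_≡_)
open import Relation.Nullary using (¬_)

record Graph : Set₁ where
  field
    n       : ℕ
    Adj     : Fin n → Fin n → Set
    symAdj  : ∀ {u v} → Adj u v → Adj v u
    irrefl  : ∀ {u} → ¬ Adj u u

module _ (G : Graph) where
  open Graph G

  data Walk : Fin n → Fin n → ℕ → Set where
    here : ∀ {u} → Walk u u zero
    step : ∀ {u w v k} → Adj u w → Walk w v k → Walk u v (suc k)

  Connected : Set
  Connected = ∀ u v → ∃ λ k → Walk u v k

  IsShortestPathDistance : (Fin n → Fin n → ℕ) → Set
  IsShortestPathDistance d =
    ∀ u v → Walk u v (d u v) × (∀ k → Walk u v k → d u v ≤ k)

  module _ (d : Fin n → Fin n → ℕ) where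

    Interval : Fin n → Fin n → Fin n → Set
    Interval u w t = d u t + d t w ≡ d u w

    MetricTriangle : Fin n → Fin n → Fin n → Set
    MetricTriangle x y z =
      (∀ t → Interval x y t → Interval x z t → t ≡ x) ×
      (∀ t → Interval x y t → Interval y z t → t ≡ y) ×
      (∀ t → Interval x z t → Interval y z t → t ≡ z)

    Meshed : Set
    Meshed = ∀ v x y → d x y ≡ 2 →
      Σ (Fin n) λ z → Adj x z × Adj y z × 2 * d v z ≤ d v x + d v y

    TriangleCondition : Set
    TriangleCondition = ∀ v x y → MetricTriangle v x y → d x y ≡ 2 →
      d v x ≡ 2 × d v y ≡ 2 ×
      Σ (Fin n) λ z → Adj x z × Adj y z × d v z ≡ 2

-- The mesh property yields the triangle condition
-- TC(v) of weakly modular graphs: adjacent vertices at distance k+1 from v have a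
-- common neighbour at distance k. In a metric triangle vxy with d(x,y) = 2, a mesh
-- point z of x and y is at the same distance m from v as x and y, and m ∉ {0, 1}.
-- If m ≥ 2, a step down by TC, a step down by the mesh property and another step down
-- by TC reach a vertex t at distance m - 2 from v and 2 from both x and y; then
-- t ∈ I(v,x) ∩ I(v,y) forces t = v, i.e. m = 2.
--
-- Triangle condition ⇒ meshed. Fix x, y with d(x,y) = 2 and induct on d(w,x). If some
-- t ≠ w lies in I(w,x) ∩ I(w,y), a mesh point for t also serves for w. Otherwise, if w
-- had no mesh point, then w x y would be a metric triangle, and the triangle condition
-- provides one.
module Submission where

open import Defs
open import Data.Empty using (⊥-elim)
open import Data.Fin using (Fin) renaming (_≟_ to _≟ᶠ_)
open import Data.Fin.Properties using (any?)
open import Data.Nat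
open import Data.Nat.Induction using (<-wellFounded)
open import Data.Nat.Properties
open import Data.Nat.Solver using (module +-*-Solver)
open import Data.Product using (Σ; ∃; _×_; _,_; proj₁; proj₂)
open import Data.Sum using (_⊎_; inj₁; inj₂)
open import Function using (_∘_)
open import Function.Bundles using (_⇔_; mk⇔)
open import Induction.WellFounded using (Acc; acc)
open import Relation.Binary.PropositionalEquality
open import Relation.Nullary using (¬_; Dec; yes; no)
open import Relation.Nullary.Decidable using (map′; ¬?; _×-dec_)

open +-*-Solver using (solve; _:=_; _:+_; _:*_; con)

2*m≡m+m : ∀ m → 2 * m ≡ m + m
2*m≡m+m m = cong (m +_) (+-identityʳ m)

2*m≤n+1+n⇒m≤n : ∀ {m n} → 2 * m ≤ n + suc n → m ≤ n
2*m≤n+1+n⇒m≤n {m} {n} h = ≮⇒≥ λ n<m →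
  1+n≰n (+-cancelʳ-≤ (suc n) (suc n) n
    (≤-trans (+-mono-≤ n<m n<m) (subst (_≤ n + suc n) (2*m≡m+m m) h)))

m≤k⇒n≤k⇒2*k≤m+n⇒m≡k×n≡k : ∀ {m n k} → m ≤ k → n ≤ k → 2 * k ≤ m + n → m ≡ k × n ≡ k
m≤k⇒n≤k⇒2*k≤m+n⇒m≡k×n≡k {m} {n} {k} m≤k n≤k h =
  ≤-antisym m≤k (+-cancelʳ-≤ k k m (≤-trans k+k≤m+n (+-monoʳ-≤ m n≤k))) ,
  ≤-antisym n≤k (+-cancelˡ-≤ k k n (≤-trans k+k≤m+n (+-monoˡ-≤ n m≤k)))
  where
  k+k≤m+n : k + k ≤ m + n
  k+k≤m+n = subst (_≤ m + n) (2*m≡m+m k) h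

m<n⇒m≤1+o⇒2*m≤n+o : ∀ {m n o} → m < n → m ≤ suc o → 2 * m ≤ n + o
m<n⇒m≤1+o⇒2*m≤n+o {m} {n} {o} m<n m≤1+o = subst (_≤ n + o) (sym (2*m≡m+m m))
  (s≤s⁻¹ (subst (suc (m + m) ≤_) (+-suc n o) (+-mono-≤ m<n m≤1+o)))

m≤n+o⇒2*o≤p+q⇒2*m≤[n+p]+[n+q] : ∀ {m n o p q} →
  m ≤ n + o → 2 * o ≤ p + q → 2 * m ≤ (n + p) + (n + q)
m≤n+o⇒2*o≤p+q⇒2*m≤[n+p]+[n+q] {m} {n} {o} {p} {q} m≤n+o h = begin
  2 * m              ≤⟨ *-monoʳ-≤ 2 m≤n+o ⟩
  2 * (n + o)        ≡⟨ *-distribˡ-+ 2 n o ⟩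
  2 * n + 2 * o      ≤⟨ +-monoʳ-≤ (2 * n) h ⟩
  2 * n + (p + q)    ≡⟨ solve 3 (λ n p q → con 2 :* n :+ (p :+ q) := (n :+ p) :+ (n :+ q)) refl n p q ⟩
  (n + p) + (n + q)  ∎
  where open ≤-Reasoning

m+n≡2⇒m≡0⊎m≡n≡1⊎n≡0 : ∀ m n → m + n ≡ 2 → m ≡ 0 ⊎ (m ≡ 1 × n ≡ 1) ⊎ n ≡ 0
m+n≡2⇒m≡0⊎m≡n≡1⊎n≡0 zero                n                _  = inj₁ refl
m+n≡2⇒m≡0⊎m≡n≡1⊎n≡0 (suc zero)          (suc zero)       _  = inj₂ (inj₁ (refl , refl))
m+n≡2⇒m≡0⊎m≡n≡1⊎n≡0 (suc (suc zero))    zero             _  = inj₂ (inj₂ refl)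
m+n≡2⇒m≡0⊎m≡n≡1⊎n≡0 (suc zero)          zero             ()
m+n≡2⇒m≡0⊎m≡n≡1⊎n≡0 (suc zero)          (suc (suc _))    ()
m+n≡2⇒m≡0⊎m≡n≡1⊎n≡0 (suc (suc zero))    (suc _)          ()
m+n≡2⇒m≡0⊎m≡n≡1⊎n≡0 (suc (suc (suc _))) _                ()

module _ {G : Graph} where
  open Graph G

  _++ʷ_ : ∀ {u v w k l} → Walk G u v k → Walk G v w l → Walk G u w (k + l)
  here     ++ʷ q = q
  step a p ++ʷ q = step a (p ++ʷ q)

  snocʷ : ∀ {u v w k} → Walk G u v k → Adj v w → Walk G u w (suc k)
  snocʷ here       a = step a here
  snocʷ (step b p) a = step b (snocʷ p a)

  reverseʷ : ∀ {u v k} → Walk G u v k → Walk G v u k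
  reverseʷ here       = here
  reverseʷ (step a p) = snocʷ (reverseʷ p) (symAdj a)

module _ (G : Graph) (d : Fin (Graph.n G) → Fin (Graph.n G) → ℕ) (isSP : IsShortestPathDistance G d) where
  open Graph G

  private
    V : Set
    V = Fin n

    variable
      u v w x y z t : V
      k l : ℕ

  shortestWalk : ∀ u v → Walk G u v (d u v)
  shortestWalk u v = proj₁ (isSP u v)

  d-minimal : Walk G u v k → d u v ≤ k
  d-minimal {u} {v} {k} = proj₂ (isSP u v) k

  d-refl : ∀ u → d u u ≡ 0
  d-refl u = n≤0⇒n≡0 (d-minimal (here {G} {u}))

  d≡0⇒≡ : d u v ≡ 0 → u ≡ v
  d≡0⇒≡ {u} {v} e with subst (Walk G u v) e (shortestWalk u v)
  ... | here = refl

  ≢⇒d>0 : u ≢ v → 0 < d u v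
  ≢⇒d>0 u≢v = n≢0⇒n>0 (u≢v ∘ d≡0⇒≡)

  d-sym : ∀ u v → d u v ≡ d v u
  d-sym u v = ≤-antisym (d-minimal (reverseʷ (shortestWalk v u))) (d-minimal (reverseʷ (shortestWalk u v)))

  d-triangle : ∀ u v w → d u w ≤ d u v + d v w
  d-triangle u v w = d-minimal (shortestWalk u v ++ʷ shortestWalk v w)

  d-neighbour : Adj u w → d v w ≤ suc (d v u)
  d-neighbour {u} {w} {v} a = d-minimal (snocʷ (shortestWalk v u) a)

  adj⇒d≤1 : Adj u v → d u v ≤ 1
  adj⇒d≤1 a = d-minimal (step a here)

  path₂⇒d≤2 : Adj u v → Adj v w → d u w ≤ 2
  path₂⇒d≤2 a b = d-minimal (step a (step b here))

  adj⇒≢ : Adj u v → u ≢ v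
  adj⇒≢ a refl = irrefl a

  adj⇒d≡1 : Adj u v → d u v ≡ 1
  adj⇒d≡1 a = ≤-antisym (adj⇒d≤1 a) (≢⇒d>0 (adj⇒≢ a))

  d≡1⇒adj : d u v ≡ 1 → Adj u v
  d≡1⇒adj {u} {v} e with subst (Walk G u v) e (shortestWalk u v)
  ... | step a here = a

  d≤1⇒adj : u ≢ v → d u v ≤ 1 → Adj u v
  d≤1⇒adj u≢v d≤1 = d≡1⇒adj (≤-antisym d≤1 (≢⇒d>0 u≢v))

  d≤2⇒adj⊎d≡2 : u ≢ v → d u v ≤ 2 → Adj u v ⊎ d u v ≡ 2
  d≤2⇒adj⊎d≡2 u≢v d≤2 with m≤n⇒m<n∨m≡n d≤2
  ... | inj₁ d<2 = inj₁ (d≤1⇒adj u≢v (s≤s⁻¹ d<2))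
  ... | inj₂ d≡2 = inj₂ d≡2

  adj? : ∀ u v → Dec (Adj u v)
  adj? u v = map′ d≡1⇒adj adj⇒d≡1 (d u v ≟ 1)

  d≡2⇒midpoint : d u w ≡ 2 → Σ V λ v → Adj u v × Adj v w
  d≡2⇒midpoint {u} {w} e with subst (Walk G u w) e (shortestWalk u w)
  ... | step a (step b here) = _ , a , b

  predecessor : d v u ≡ suc k → Σ V λ w → Adj u w × d v w ≡ k
  predecessor {v} {u} {k} e with subst (Walk G u v) (trans (d-sym u v) e) (shortestWalk u v)
  ... | step {w = w} a rest = w , a , ≤-antisym (subst (_≤ k) (d-sym w v) (d-minimal rest))
                                               (s≤s⁻¹ (subst (_≤ suc (d v w)) e (d-neighbour (symAdj a))))

  distinct-levels : d v u ≡ k → d v w ≡ suc k → u ≢ w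
  distinct-levels eu ew refl = 1+n≢n (trans (sym ew) eu)

  d-pinned : d v u ≡ k → d v w ≡ l + k → d u w ≤ l → d u w ≡ l
  d-pinned {v} {u} {k} {w} {l} eu ew d≤l = ≤-antisym d≤l (+-cancelʳ-≤ k l (d u w) (begin
    l + k          ≡⟨ sym ew ⟩
    d v w          ≤⟨ d-triangle v u w ⟩
    d v u + d u w  ≡⟨ cong (_+ d u w) eu ⟩
    k + d u w      ≡⟨ +-comm k (d u w) ⟩
    d u w + k      ∎))
    where open ≤-Reasoning

  ∈I-pinned : d v t ≡ k → d v x ≡ l + k → d t x ≤ l → Interval G d v x t
  ∈I-pinned {v} {t} {k} {x} {l} et ex d≤l = begin
    d v t + d t x  ≡⟨ cong₂ _+_ et (d-pinned et ex d≤l) ⟩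
    k + l          ≡⟨ +-comm k l ⟩
    l + k          ≡⟨ sym ex ⟩
    d v x          ∎
    where open ≡-Reasoning

  neighbour-not-nearer : Adj t x → (Interval G d v x t → t ≡ x) → d v x ≤ d v t
  neighbour-not-nearer {t} {x} {v} a only-x = ≮⇒≥ λ nearer →
    adj⇒≢ a (only-x (∈I-pinned refl (sym (≤-antisym nearer (d-neighbour a))) (adj⇒d≤1 a)))

  ∈I⇒nearer : t ≢ w → Interval G d w x t → d t x < d w x
  ∈I⇒nearer {t} {w} {x} t≢w wxt = subst (d t x <_) wxt (m<n+m (d t x) (≢⇒d>0 (≢-sym t≢w)))

  Interval-sym : Interval G d x y t → Interval G d y x t
  Interval-sym {x} {y} {t} xyt = begin
    d y t + d t x  ≡⟨ cong₂ _+_ (d-sym y t) (d-sym t x) ⟩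
    d t y + d x t  ≡⟨ +-comm (d t y) (d x t) ⟩
    d x t + d t y  ≡⟨ xyt ⟩
    d x y          ≡⟨ d-sym x y ⟩
    d y x          ∎
    where open ≡-Reasoning

  MeshPoint : V → V → V → Set
  MeshPoint v x y = Σ V λ z → Adj x z × Adj y z × 2 * d v z ≤ d v x + d v y

  meshPoint? : ∀ v x y → Dec (MeshPoint v x y)
  meshPoint? v x y = any? λ z → adj? x z ×-dec adj? y z ×-dec (2 * d v z ≤? d v x + d v y)

  MeshPoint-swap : MeshPoint v x y → MeshPoint v y x
  MeshPoint-swap {v} {x} {y} (z , x~z , y~z , h) =
    z , y~z , x~z , subst (2 * d v z ≤_) (+-comm (d v x) (d v y)) h

  meshed-descend : Meshed G d → d x y ≡ 2 → d v x ≡ k → d v y ≡ suc k →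
                   Σ V λ z → Adj x z × Adj y z × d v z ≡ k
  meshed-descend {x} {y} {v} {k} M dxy ex ey with M v x y dxy
  ... | z , x~z , y~z , h = z , x~z , y~z ,
    ≤-antisym (2*m≤n+1+n⇒m≤n (subst (2 * d v z ≤_) (cong₂ _+_ ex ey) h))
              (s≤s⁻¹ (subst (_≤ suc (d v z)) ey (d-neighbour (symAdj y~z))))

  meshed⇒TC : Meshed G d → ∀ v k → Adj x y → d v x ≡ suc k → d v y ≡ suc k →
              Σ V λ z → Adj x z × Adj y z × d v z ≡ k
  meshed⇒TC {x} {y} M v zero _ ex ey =
    v , d≡1⇒adj (trans (d-sym x v) ex) , d≡1⇒adj (trans (d-sym y v) ey) , d-refl v
  meshed⇒TC {x} {y} M v (suc j) x~y ex ey with predecessor ex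
  ... | x′ , x~x′ , ex′ with d≤2⇒adj⊎d≡2 (distinct-levels ex′ ey) (path₂⇒d≤2 (symAdj x~x′) x~y)
  ... | inj₁ x′~y = x′ , x~x′ , symAdj x′~y , ex′
  ... | inj₂ dx′y with meshed-descend M dx′y ex′ ey
  ... | w , x′~w , y~w , ew with meshed⇒TC M v j x′~w ex′ ew
  ... | c , x′~c , w~c , ec
    with M y x c (trans (d-sym x c) (d-pinned ec ex (path₂⇒d≤2 (symAdj x′~c) (symAdj x~x′))))
  ... | u , x~u , c~u , h = u , x~u , y~u , eu
    where
    eu : d v u ≡ suc j
    eu = ≤-antisym (subst (λ m → d v u ≤ suc m) ec (d-neighbour c~u))
                   (s≤s⁻¹ (subst (_≤ suc (d v u)) ex (d-neighbour (symAdj x~u))))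
    y~u : Adj y u
    y~u = d≤1⇒adj (≢-sym (distinct-levels eu ey)) (2*m≤n+1+n⇒m≤n (≤-trans h
            (+-mono-≤ (≤-reflexive (adj⇒d≡1 (symAdj x~y))) (path₂⇒d≤2 y~w w~c))))

  meshed-triangle-height : Meshed G d → MetricTriangle G d v x y → d x y ≡ 2 → Adj x z → Adj y z →
                           d v x ≡ k → d v y ≡ k → d v z ≡ k → k ≡ 2
  meshed-triangle-height {v} {x} {y} {k = zero} _ _ dxy _ _ ex ey _ with d≡0⇒≡ ex | d≡0⇒≡ ey
  ... | refl | refl = ⊥-elim (0≢1+n (trans (sym (d-refl v)) dxy))
  meshed-triangle-height {v} {x} {y} {k = suc zero} _ (_ , x-apex , _) dxy _ _ ex ey _
    with x-apex v (cong (_+ d v x) (d-refl v)) (trans (cong₂ _+_ (trans (d-sym x v) ex) ey) (sym dxy))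
  ... | refl = ⊥-elim (0≢1+n (trans (sym (d-refl v)) ex))
  meshed-triangle-height {v} {x} {y} {k = suc (suc j)} M (v-apex , _) _ x~z y~z ex ey ez
    with meshed⇒TC M v (suc j) x~z ex ez
  ... | c , x~c , z~c , ec with d≤2⇒adj⊎d≡2 (distinct-levels ec ey) (path₂⇒d≤2 (symAdj z~c) (symAdj y~z))
  ... | inj₁ c~y with v-apex c (∈I-pinned ec ex (adj⇒d≤1 (symAdj x~c))) (∈I-pinned ec ey (adj⇒d≤1 c~y))
  ...   | refl = ⊥-elim (0≢1+n (trans (sym (d-refl c)) ec))
  meshed-triangle-height {v} {x} {y} {k = suc (suc j)} M (v-apex , _) _ x~z y~z ex ey ez
      | c , x~c , z~c , ec | inj₂ dcy with meshed-descend M dcy ec ey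
  ... | u , c~u , y~u , eu with meshed⇒TC M v j c~u ec eu
  ... | t , c~t , u~t , et with v-apex t (∈I-pinned et ex (path₂⇒d≤2 (symAdj c~t) (symAdj x~c)))
                                        (∈I-pinned et ey (path₂⇒d≤2 (symAdj u~t) (symAdj y~u)))
  ... | refl = cong (suc ∘ suc) (trans (sym et) (d-refl t))

  meshed⇒triangleCondition : Meshed G d → TriangleCondition G d
  meshed⇒triangleCondition M v x y vxy@(_ , x-apex , y-apex) dxy with M v x y dxy
  ... | z , x~z , y~z , h =
    subst (_≡ 2) (sym ex) height , subst (_≡ 2) (sym ey) height , z , x~z , y~z , height
    where
    zxy : Interval G d x y z
    zxy = trans (cong₂ _+_ (adj⇒d≡1 x~z) (adj⇒d≡1 (symAdj y~z))) (sym dxy)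
    equidistant : d v x ≡ d v z × d v y ≡ d v z
    equidistant = m≤k⇒n≤k⇒2*k≤m+n⇒m≡k×n≡k
      (neighbour-not-nearer (symAdj x~z) λ vxz → x-apex z vxz zxy)
      (neighbour-not-nearer (symAdj y~z) λ vyz → y-apex z vyz zxy) h
    ex : d v x ≡ d v z
    ex = proj₁ equidistant
    ey : d v y ≡ d v z
    ey = proj₂ equidistant
    height : d v z ≡ 2
    height = meshed-triangle-height M vxy dxy x~z y~z ex ey refl

  MeshPoint-via : Interval G d w x t → Interval G d w y t → MeshPoint t x y → MeshPoint w x y
  MeshPoint-via {w} {x} {t} {y} wxt wyt (z , x~z , y~z , h) = z , x~z , y~z ,
    subst₂ (λ p q → 2 * d w z ≤ p + q) wxt wyt
      (m≤n+o⇒2*o≤p+q⇒2*m≤[n+p]+[n+q] {n = d w t} {p = d t x} {q = d t y} (d-triangle w t z) h)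

  apex-isolated : d x y ≡ 2 → ¬ MeshPoint w x y → Interval G d w x t → Interval G d x y t → t ≡ x
  apex-isolated {x} {y} {w} {t} dxy ¬mp wxt xyt with m+n≡2⇒m≡0⊎m≡n≡1⊎n≡0 (d x t) (d t y) (trans xyt dxy)
  ... | inj₁ dxt≡0 = sym (d≡0⇒≡ dxt≡0)
  ... | inj₂ (inj₁ (dxt≡1 , dty≡1)) = ⊥-elim (¬mp (t , d≡1⇒adj dxt≡1 , y~t ,
          m<n⇒m≤1+o⇒2*m≤n+o (≤-reflexive (trans (+-comm 1 (d w t)) wt+1≡wx)) (d-neighbour y~t)))
    where
    y~t : Adj y t
    y~t = d≡1⇒adj (trans (d-sym y t) dty≡1)
    wt+1≡wx : d w t + 1 ≡ d w x
    wt+1≡wx = trans (cong (d w t +_) (trans (sym dxt≡1) (d-sym x t))) wxt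
  ... | inj₂ (inj₂ dty≡0) with d≡0⇒≡ dty≡0
  ...   | refl with d≡2⇒midpoint dxy
  ...   | m , x~m , m~y = ⊥-elim (¬mp (m , x~m , symAdj m~y ,
          m<n⇒m≤1+o⇒2*m≤n+o (≤-trans (s≤s wm≤1+wt) (≤-reflexive (trans (+-comm 2 (d w t)) wt+2≡wx)))
                            wm≤1+wt))
    where
    wm≤1+wt : d w m ≤ suc (d w t)
    wm≤1+wt = d-neighbour (symAdj m~y)
    wt+2≡wx : d w t + 2 ≡ d w x
    wt+2≡wx = trans (cong (d w t +_) (trans (sym dxy) (d-sym x t))) wxt

  module _ (T : TriangleCondition G d) {x y : V} (dxy : d x y ≡ 2) where

    StrictlyBetween : V → Set
    StrictlyBetween w = ∃ λ t → t ≢ w × Interval G d w x t × Interval G d w y t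

    strictlyBetween? : ∀ w → Dec (StrictlyBetween w)
    strictlyBetween? w = any? λ t → ¬? (t ≟ᶠ w) ×-dec (d w t + d t x ≟ d w x) ×-dec (d w t + d t y ≟ d w y)

    metricTriangle : ¬ StrictlyBetween w → ¬ MeshPoint w x y → MetricTriangle G d w x y
    metricTriangle {w} none ¬mp = w-apex , (λ _ → apex-isolated dxy ¬mp) ,
      λ _ wyt xyt → apex-isolated (trans (d-sym y x) dxy) (¬mp ∘ MeshPoint-swap) wyt (Interval-sym xyt)
      where
      w-apex : ∀ t → Interval G d w x t → Interval G d w y t → t ≡ w
      w-apex t wxt wyt with t ≟ᶠ w
      ... | yes t≡w = t≡w
      ... | no t≢w  = ⊥-elim (none (t , t≢w , wxt , wyt))

    meshPoint : ∀ w → Acc _<_ (d w x) → MeshPoint w x y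
    meshPoint w (acc rec) with meshPoint? w x y
    ... | yes mp = mp
    ... | no ¬mp with strictlyBetween? w
    ... | yes (t , t≢w , wxt , wyt) = MeshPoint-via wxt wyt (meshPoint t (rec (∈I⇒nearer t≢w wxt)))
    ... | no none with T w x y (metricTriangle none ¬mp) dxy
    ... | wx≡2 , wy≡2 , z , x~z , y~z , wz≡2 =
      z , x~z , y~z , subst₂ _≤_ (cong (2 *_) (sym wz≡2)) (cong₂ _+_ (sym wx≡2) (sym wy≡2)) ≤-refl

  triangleCondition⇒meshed : TriangleCondition G d → Meshed G d
  triangleCondition⇒meshed T v x y dxy = meshPoint T dxy v (<-wellFounded (d v x))

mainTheorem3 : (G : Graph) → Connected G →
    (d : Fin (Graph.n G) → Fin (Graph.n G) → ℕ) → IsShortestPathDistance G d →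
    Meshed G d ⇔ TriangleCondition G d
mainTheorem3 G _ d isSP = mk⇔ (meshed⇒triangleCondition G d isSP) (triangleCondition⇒meshed G d isSP)
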